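{- Let $G$ be a graph and let $P_1=x_0x_1\dots x_p$ and $P_2=y_0y_1\dots y_q$ be vertex-disjoint paths of $G$ (chords allowed) such that for every $0\le i<p$ and $0\le j<q$, the set $\{x_i,x_{i+1},y_j,y_{j+1}\}$ is the vertex set of an alternating cycle of $G$. Then $x_0x_p|y_0y_q\in RQ(G)$, i.e. every unweighted leaf root of $G$ (if one exists) contains the quartet $x_0x_p|y_0y_q$.
   Context: A sequence $C=(x_0,y_0,\dots,x_{c-1},y_{c-1})$ of distinct vertices of $G$ is an alternating cycle if $x_iy_i\in E(G)$ and $y_ix_{i+1}\notin E(G)$ for all $i$ (indices modulo $c$). For a tree $T$ with weighting $f:E(T)\to\mathbb{N}^+$, $d_f(x,y)$ is the sum of weights on the $x$–$y$ path; $(T,f)$ with leaf set $V(G)$ is a leaf root of $G$ if there is an integer $k$ such that for all distinct $u,v$, $uv\in E(G)$ iff $d_f(u,v)\le k$; an unweighted tree $T$ is an unweighted leaf root of $G$ if some such $f$ makes $(T,f)$ a leaf root of $G$. A tree $T$ contains the quartet $ab|cd$ if $a,b,c,d$ are leaves of $T$ and the $a$–$b$ path does not intersect the $c$–$d$ path. $RQ(G)$ denotes the set of quartets contained in every unweighted leaf root of $G$. -}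

module Defs where

open import Data.Nat using (ℕ; zero; suc; _+_; _≥_)
open import Data.Integer using (ℤ; +_) renaming (_≤_ to _≤ℤ_)
open import Data.Bool using (Bool; true; false)
open import Data.Fin using (Fin; inject₁) renaming (suc to fsuc)
open import Data.List using (List; []; _∷_; length; filterᵇ; allFin; concatMap)
open import Data.List.Membership.Propositional using (_∈_; _∉_)
open import Data.List.Relation.Unary.Unique.Propositional using (Unique)
open import Data.Product using (Σ; ∃; ∃-syntax; _×_; _,_)
open import Relation.Nullary using (¬_)
open import Data.Empty using (⊥)
open import Relation.Binary.PropositionalEquality using (_≡_; _≢_)
open import Function.Bundles using (_⇔_)
open import Function.Definitions using (Injective)

record Graph : Set where
  field
    n      : ℕ
    E      : Fin n → Fin n → Bool
    sym    : ∀ u v → E u v ≡ E v u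
    irrefl : ∀ u → E u u ≡ false

open Graph public

V : Graph → Set
V G = Fin (n G)

Adj : (G : Graph) → V G → V G → Set
Adj G u v = E G u v ≡ true

data Walk (G : Graph) : V G → V G → List (V G) → Set where
  here : ∀ {u} → Walk G u u (u ∷ [])
  step : ∀ {u w v vs} → Adj G u w → Walk G w v vs → Walk G u v (u ∷ vs)

Path : (G : Graph) → V G → V G → List (V G) → Set
Path G u v vs = Walk G u v vs × Unique vs

Connected : Graph → Set
Connected G = ∀ (u v : V G) → ∃[ vs ] Walk G u v vs

HasCycle : Graph → Set
HasCycle G = ∃[ u ] ∃[ w ] ∃[ vs ] (Path G u w vs × length vs ≥ 3 × Adj G w u)

IsTree : Graph → Set
IsTree G = Connected G × ¬ HasCycle G

degree : (G : Graph) → V G → ℕ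
degree G v = length (filterᵇ (E G v) (allFin (n G)))

IsLeaf : (G : Graph) → V G → Set
IsLeaf G v = degree G v ≡ 1

-- f : E(T) → ℕ⁺, given as a symmetric function on pairs, positive on edges
IsWeighting : (T : Graph) → (V T → V T → ℕ) → Set
IsWeighting T f = (∀ u v → f u v ≡ f v u) × (∀ u v → Adj T u v → f u v ≥ 1)

weight : ∀ {A : Set} → (A → A → ℕ) → List A → ℕ
weight f []           = 0
weight f (_ ∷ [])     = 0
weight f (u ∷ w ∷ vs) = f u w + weight f (w ∷ vs)

HasLeafSet : (G T : Graph) → (V G → V T) → Set
HasLeafSet G T ι =
  IsTree T × Injective _≡_ _≡_ ι × (∀ (t : V T) → IsLeaf T t ⇔ (∃[ v ] ι v ≡ t))

-- (T, f) is a leaf root of G : d_f(u,v) ≤ k iff uv ∈ E(G), d_f measured along the tree path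
IsLeafRoot : (G T : Graph) → (V G → V T) → (V T → V T → ℕ) → Set
IsLeafRoot G T ι f =
  HasLeafSet G T ι × IsWeighting T f ×
  ∃[ k ] (∀ (u v : V G) → u ≢ v → ∀ vs → Path T (ι u) (ι v) vs →
            (Adj G u v ⇔ ((+ weight f vs) ≤ℤ k)))

IsUnweightedLeafRoot : (G T : Graph) → (V G → V T) → Set
IsUnweightedLeafRoot G T ι = ∃[ f ] IsLeafRoot G T ι f

ContainsQuartet : (G T : Graph) → (V G → V T) → (a b c d : V G) → Set
ContainsQuartet G T ι a b c d =
  ∀ P Q → Path T (ι a) (ι b) P → Path T (ι c) (ι d) Q → ∀ t → t ∈ P → t ∉ Q

InRQ : (G : Graph) → (a b c d : V G) → Set
InRQ G a b c d = ∀ (T : Graph) (ι : V G → V T) →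
  IsUnweightedLeafRoot G T ι → ContainsQuartet G T ι a b c d

-- Alternating cycles: sequence (x₀,y₀,…,x_{c-1},y_{c-1}) as a list of pairs

flatten : ∀ {A : Set} → List (A × A) → List A
flatten = concatMap (λ { (x , y) → x ∷ y ∷ [] })

-- consecutive-condition: y_i x_{i+1} ∉ E, wrapping back to x₀ at the end
data AltChain (G : Graph) (x₀ : V G) : List (V G × V G) → Set where
  last : ∀ {x y} → Adj G x y → ¬ Adj G y x₀ → AltChain G x₀ ((x , y) ∷ [])
  cons : ∀ {x y x' y' rest} → Adj G x y → ¬ Adj G y x' →
         AltChain G x₀ ((x' , y') ∷ rest) → AltChain G x₀ ((x , y) ∷ (x' , y') ∷ rest)

IsAlternatingCycle : (G : Graph) → List (V G × V G) → Set
IsAlternatingCycle G [] = ⊥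
IsAlternatingCycle G ((x₀ , y₀) ∷ rest) =
  Unique (flatten ((x₀ , y₀) ∷ rest)) × AltChain G x₀ ((x₀ , y₀) ∷ rest)

IsAltCycleVertexSet : (G : Graph) → List (V G) → Set
IsAltCycleVertexSet G S =
  ∃[ C ] (IsAlternatingCycle G C × (∀ v → (v ∈ flatten C) ⇔ (v ∈ S)))

-- x : Fin (suc p) → V G is a path x₀x₁…x_p of G (chords allowed)
IsGraphPath : (G : Graph) (p : ℕ) → (Fin (suc p) → V G) → Set
IsGraphPath G p x = Injective _≡_ _≡_ x × (∀ (i : Fin p) → Adj G (x (inject₁ i)) (x (fsuc i)))

-- Fix a leaf root (T, f) with threshold k and suppose some vertex t of T lies both on the
-- tree path from x₀ to x_p and on the one from y₀ to y_q. Tree paths are unique, so t lies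
-- on the tree path of some edge x_i x_{i+1} and of some edge y_j y_{j+1}. With h(v) = d_f(t, v)
-- these edges give h x_i + h x_{i+1} ≤ k and h y_j + h y_{j+1} ≤ k, while every non-edge uv
-- among these four vertices has h u + h v ≥ d_f(u, v) > k. An alternating cycle on the four
-- vertices has two disjoint non-edges covering them, so its h-sum would exceed 2k: contradiction.
-- If p = 0 (or q = 0) the vertex t is the leaf x₀ itself, and a leaf is never an inner vertex
-- of a path.
module Submission where

open import Defs
open import Data.Bool.Properties using (T-≡)
open import Data.Empty using (⊥-elim)
open import Data.Fin using (Fin; zero; fromℕ; inject₁) renaming (suc to fsuc)
open import Data.Fin.Properties using (_≟_)
open import Data.Integer using (ℤ; +_) renaming (_≤_ to _≤ℤ_; _<_ to _<ℤ_)
open import Data.Integer.Base using (+≤+)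
import Data.Integer.Properties as ℤ
open import Data.List using (List; []; _∷_; _++_; drop; reverse; length; map; filterᵇ; allFin)
open import Data.List.Properties using (unfold-reverse; map-++; length-++)
open import Data.List.Membership.Propositional using (_∈_)
open import Data.List.Membership.Propositional.Properties using (∈-++⁻; ∈-∃++; ∈-allFin; ∈-filter⁺; ∈-length)
open import Data.List.Relation.Binary.Permutation.Propositional using (_↭_; ↭-refl; ↭-trans; prep)
open import Data.List.Relation.Binary.Permutation.Propositional.Properties using (shift; ∈-resp-↭; ↭-length)
import Data.List.Relation.Binary.Permutation.Propositional.Properties as ↭
open import Data.List.Relation.Binary.Subset.Propositional using (_⊆_)
open import Data.List.Relation.Unary.All using (All; []; _∷_)
import Data.List.Relation.Unary.All as All
open import Data.List.Relation.Unary.All.Properties using (¬Any⇒All¬)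
open import Data.List.Relation.Unary.AllPairs using ([]; _∷_)
open import Data.List.Relation.Unary.Any using (here; there; any?)
open import Data.List.Relation.Unary.Any.Properties using (reverse⁻)
open import Data.List.Relation.Unary.Unique.Propositional using (Unique)
open import Data.Nat using (ℕ; zero; suc; _+_; _≤_; s≤s)
open import Data.Nat.ListAction using (sum)
open import Data.Nat.ListAction.Properties using (sum-++; sum-↭)
import Data.Nat.Properties as ℕ
open import Data.Nat.Tactic.RingSolver using (solve-∀)
open import Data.Product using (∃-syntax; ∃₂; _×_; _,_; proj₁; proj₂)
open import Data.Sum using (_⊎_; inj₁; inj₂)
import Data.Sum as Sum
open import Function using (_∘_; id)
open import Function.Bundles using (Equivalence)
open import Relation.Nullary using (¬_; yes; no; contradiction)
open import Relation.Binary.PropositionalEquality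
  using (_≡_; _≢_; refl; trans; cong; cong₂; subst; subst₂; module ≡-Reasoning)
import Relation.Binary.PropositionalEquality as ≡

module _ {A : Set} where

  ∈⇒↭∷ : ∀ {x : A} {ys} → x ∈ ys → ∃[ rest ] ys ↭ x ∷ rest
  ∈⇒↭∷ {x} x∈ys with ys₁ , ys₂ , refl ← ∈-∃++ x∈ys = ys₁ ++ ys₂ , shift x ys₁ ys₂

  unique-⊆⇒↭++ : ∀ {xs ys : List A} → Unique xs → xs ⊆ ys → ∃[ zs ] ys ↭ xs ++ zs
  unique-⊆⇒↭++ {[]} {ys} [] _ = ys , ↭-refl
  unique-⊆⇒↭++ {x ∷ xs} (x∉xs ∷ xs!) x∷xs⊆ys =
    proj₁ rest↭xs++zs , ↭-trans ys↭x∷rest (prep x (proj₂ rest↭xs++zs))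
    where
    rest : List A
    rest = proj₁ (∈⇒↭∷ (x∷xs⊆ys (here refl)))
    ys↭x∷rest : _ ↭ x ∷ rest
    ys↭x∷rest = proj₂ (∈⇒↭∷ (x∷xs⊆ys (here refl)))
    xs⊆rest : xs ⊆ rest
    xs⊆rest z∈xs with ∈-resp-↭ ys↭x∷rest (x∷xs⊆ys (there z∈xs))
    ... | here refl    = contradiction refl (All.lookup x∉xs z∈xs)
    ... | there z∈rest = z∈rest
    rest↭xs++zs : ∃[ zs ] rest ↭ xs ++ zs
    rest↭xs++zs = unique-⊆⇒↭++ xs! xs⊆rest

  unique-⊆⇒length≤ : ∀ {xs ys : List A} → Unique xs → xs ⊆ ys → length xs ≤ length ys
  unique-⊆⇒length≤ {xs} xs! xs⊆ys with zs , ρ ← unique-⊆⇒↭++ xs! xs⊆ys =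
    subst (length xs ≤_) (≡.sym (trans (↭-length ρ) (length-++ xs))) (ℕ.m≤m+n _ _)

  unique-⊆⇒sum≤ : ∀ (h : A → ℕ) {xs ys : List A} → Unique xs → xs ⊆ ys →
                  sum (map h xs) ≤ sum (map h ys)
  unique-⊆⇒sum≤ h {xs} {ys} xs! xs⊆ys with zs , ρ ← unique-⊆⇒↭++ xs! xs⊆ys =
    subst (sum (map h xs) ≤_) (≡.sym sum-ys) (ℕ.m≤m+n _ _)
    where
    open ≡-Reasoning
    sum-ys : sum (map h ys) ≡ sum (map h xs) + sum (map h zs)
    sum-ys = begin
      sum (map h ys)                      ≡⟨ sum-↭ (↭.map⁺ h ρ) ⟩
      sum (map h (xs ++ zs))              ≡⟨ cong sum (map-++ h xs zs) ⟩
      sum (map h xs ++ map h zs)          ≡⟨ sum-++ (map h xs) (map h zs) ⟩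
      sum (map h xs) + sum (map h zs)     ∎

above-twice≰below-twice : ∀ {k : ℤ} {m n m′ n′} → k <ℤ + m → k <ℤ + n →
                          + m′ ≤ℤ k → + n′ ≤ℤ k → ¬ (m + n ≤ m′ + n′)
above-twice≰below-twice k<m k<n m′≤k n′≤k m+n≤m′+n′ =
  ℤ.<-irrefl refl
    (ℤ.<-≤-trans (ℤ.+-mono-< k<m k<n) (ℤ.≤-trans (+≤+ m+n≤m′+n′) (ℤ.+-mono-≤ m′≤k n′≤k)))

∈-drop-1⁻ : ∀ {A : Set} {x : A} xs → x ∈ drop 1 xs → x ∈ xs
∈-drop-1⁻ (_ ∷ _) = there

∈-++-drop-1⁻ : ∀ {A : Set} {x : A} xs {ys} → x ∈ xs ++ drop 1 ys → x ∈ xs ⊎ x ∈ ys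
∈-++-drop-1⁻ xs {ys} = Sum.map₂ (∈-drop-1⁻ ys) ∘ ∈-++⁻ xs

module _ {G : Graph} where

  private
    variable
      a b b′ c d s t u v w : V G
      P Q W W′ : List (V G)

  adj-sym : Adj G u v → Adj G v u
  adj-sym {u} {v} = trans (Graph.sym G v u)

  adj⇒≢ : Adj G u v → u ≢ v
  adj⇒≢ {u} u~u refl with () ← trans (≡.sym (irrefl G u)) u~u

  walk-source∈ : Walk G u v W → u ∈ W
  walk-source∈ here       = here refl
  walk-source∈ (step _ _) = here refl

  walk-target∈ : Walk G u v W → v ∈ W
  walk-target∈ here       = here refl
  walk-target∈ (step _ r) = there (walk-target∈ r)

  walk-length≥2 : Walk G u v W → u ≢ v → 2 ≤ length W
  walk-length≥2 here       u≢u = contradiction refl u≢u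
  walk-length≥2 (step _ r) _   = s≤s (∈-length (walk-source∈ r))

  _++ʷ_ : Walk G u v W → Walk G v w W′ → Walk G u w (W ++ drop 1 W′)
  here       ++ʷ here       = here
  here       ++ʷ step v~a r = step v~a r
  step u~a r ++ʷ r′         = step u~a (r ++ʷ r′)

  reverseʷ : Walk G u v W → Walk G v u (reverse W)
  reverseʷ here = here
  reverseʷ {u} {W = _ ∷ W} (step u~a r) =
    subst (Walk G _ u) (≡.sym (unfold-reverse u W)) (reverseʷ r ++ʷ step (adj-sym u~a) here)

  splitʷ : Walk G u v W → t ∈ W →
           ∃₂ λ W₁ W₂ → Walk G u t W₁ × Walk G t v W₂ × W ≡ W₁ ++ drop 1 W₂
  splitʷ here         (here refl) = _ , _ , here , here , refl
  splitʷ (step u~a r) (here refl) = _ , _ , here , step u~a r , refl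
  splitʷ {u} (step u~a r) (there t∈) with W₁ , W₂ , r₁ , r₂ , refl ← splitʷ r t∈ =
    u ∷ W₁ , W₂ , step u~a r₁ , r₂ , refl

  self-path : Path G u u P → t ∈ P → t ≡ u
  self-path (here , _)               (here t≡u) = t≡u
  self-path (step _ r , u∉ ∷ _) _ = contradiction refl (All.lookup u∉ (walk-target∈ r))

  module _ (f : V G → V G → ℕ) where

    weight-∷ʷ : Walk G a v W → weight f (u ∷ W) ≡ f u a + weight f W
    weight-∷ʷ here       = refl
    weight-∷ʷ (step _ _) = refl

    weight-++ʷ : Walk G u v W → Walk G v w W′ →
                 weight f (W ++ drop 1 W′) ≡ weight f W + weight f W′
    weight-++ʷ here here       = refl
    weight-++ʷ here (step _ _) = refl
    weight-++ʷ {u} {W = _ ∷ W} {W′ = W′} (step {w = a} u~a r) r′ = begin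
      weight f (u ∷ W ++ drop 1 W′)          ≡⟨ weight-∷ʷ (r ++ʷ r′) ⟩
      f u a + weight f (W ++ drop 1 W′)      ≡⟨ cong (λ x → f u a + x) (weight-++ʷ r r′) ⟩
      f u a + (weight f W + weight f W′)     ≡⟨ ≡.sym (ℕ.+-assoc (f u a) _ _) ⟩
      (f u a + weight f W) + weight f W′     ≡⟨ cong (_+ weight f W′) (≡.sym (weight-∷ʷ r)) ⟩
      weight f (u ∷ W) + weight f W′         ∎
      where open ≡-Reasoning

    weight-reverseʷ : (∀ u v → f u v ≡ f v u) → Walk G u v W → weight f (reverse W) ≡ weight f W
    weight-reverseʷ f-sym here = refl
    weight-reverseʷ {u} {W = _ ∷ W} f-sym (step {w = a} u~a r) = begin
      weight f (reverse (u ∷ W))             ≡⟨ cong (weight f) (unfold-reverse u W) ⟩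
      weight f (reverse W ++ u ∷ [])         ≡⟨ weight-++ʷ (reverseʷ r) (step (adj-sym u~a) here) ⟩
      weight f (reverse W) + (f a u + 0)     ≡⟨ cong₂ _+_ (weight-reverseʷ f-sym r)
                                                          (trans (ℕ.+-identityʳ _) (f-sym a u)) ⟩
      weight f W + f u a                     ≡⟨ ℕ.+-comm _ (f u a) ⟩
      f u a + weight f W                     ≡⟨ ≡.sym (weight-∷ʷ r) ⟩
      weight f (u ∷ W)                       ∎
      where open ≡-Reasoning

    weight-tail≤ : Walk G a v W → weight f W ≤ weight f (u ∷ W)
    weight-tail≤ {a} {W = W} {u} r =
      subst (weight f W ≤_) (≡.sym (weight-∷ʷ r)) (ℕ.m≤n+m (weight f W) (f u a))

  record Shortcut (u v : V G) (W : List (V G)) : Set where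
    field
      {vertices} : List (V G)
      path       : Path G u v vertices
      ⊆walk      : vertices ⊆ W
      weight≤    : ∀ f → weight f vertices ≤ weight f W

  open Shortcut public

  path⇒shortcut : Path G u v W → Shortcut u v W
  path⇒shortcut π = record { path = π ; ⊆walk = id ; weight≤ = λ _ → ℕ.≤-refl }

  path-suffix : Path G s v W → t ∈ W → Shortcut t v W
  path-suffix π@(here , _)     (here refl) = path⇒shortcut π
  path-suffix π@(step _ _ , _) (here refl) = path⇒shortcut π
  path-suffix (step _ r , _ ∷ r!) (there t∈) =
    record { path = path S ; ⊆walk = there ∘ ⊆walk S
           ; weight≤ = λ f → ℕ.≤-trans (weight≤ S f) (weight-tail≤ f r) }
    where S = path-suffix (r , r!) t∈

  shortcut : Walk G u v W → Shortcut u v W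
  shortcut here = path⇒shortcut (here , [] ∷ [])
  shortcut {u} (step {w = a} u~a r) with S ← shortcut r | any? (u ≟_) (vertices S)
  ... | yes u∈S = record
    { path    = path S′
    ; ⊆walk   = there ∘ ⊆walk S ∘ ⊆walk S′
    ; weight≤ = λ f → ℕ.≤-trans (weight≤ S′ f) (ℕ.≤-trans (weight≤ S f) (weight-tail≤ f r)) }
    where S′ = path-suffix (path S) u∈S
  ... | no u∉S = record
    { path    = step u~a (proj₁ (path S)) , ¬Any⇒All¬ _ u∉S ∷ proj₂ (path S)
    ; ⊆walk   = λ { (here e) → here e ; (there z∈) → there (⊆walk S z∈) }
    ; weight≤ = λ f → subst₂ _≤_ (≡.sym (weight-∷ʷ f (proj₁ (path S)))) (≡.sym (weight-∷ʷ f r))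
                                 (ℕ.+-monoʳ-≤ (f u a) (weight≤ S f)) }

  connecting-path : Connected G → ∀ u v → ∃[ P ] Path G u v P
  connecting-path conn u v = vertices S , path S
    where S = shortcut (proj₂ (conn u v))

  fork⇒cycle : Adj G u b → Adj G u b′ → b ≢ b′ → Walk G b v W → Walk G b′ v W′ →
               All (u ≢_) W → All (u ≢_) W′ → HasCycle G
  fork⇒cycle u~b u~b′ b≢b′ r r′ u∉W u∉W′ =
    _ , _ , _ ∷ vertices S
      , (step u~b′ (proj₁ (path S)) , All.tabulate u∉S ∷ proj₂ (path S))
      , s≤s (walk-length≥2 (proj₁ (path S)) (b≢b′ ∘ ≡.sym))
      , adj-sym u~b
    where
    S = shortcut (r′ ++ʷ reverseʷ r)
    u∉S : ∀ {z} → z ∈ vertices S → _ ≢ z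
    u∉S z∈S with ∈-++-drop-1⁻ _ (⊆walk S z∈S)
    ... | inj₁ z∈W′ = All.lookup u∉W′ z∈W′
    ... | inj₂ z∈W  = All.lookup u∉W (reverse⁻ z∈W)

  acyclic⇒path-unique : ¬ HasCycle G → Path G u v P → Path G u v Q → P ≡ Q
  acyclic⇒path-unique _ (here , _) (here , _) = refl
  acyclic⇒path-unique _ (here , _) (step _ r , u∉ ∷ _) = contradiction refl (All.lookup u∉ (walk-target∈ r))
  acyclic⇒path-unique _ (step _ r , u∉ ∷ _) (here , _) = contradiction refl (All.lookup u∉ (walk-target∈ r))
  acyclic⇒path-unique acyclic (step {w = b} u~b r , u∉ ∷ r!) (step {w = b′} u~b′ r′ , u∉′ ∷ r′!)
    with b ≟ b′
  ... | yes refl = cong (_ ∷_) (acyclic⇒path-unique acyclic (r , r!) (r′ , r′!))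
  ... | no b≢b′  = ⊥-elim (acyclic (fork⇒cycle u~b u~b′ b≢b′ r r′ u∉ u∉′))

  walk-covers-path : ¬ HasCycle G → Path G u v P → Walk G u v W → P ⊆ W
  walk-covers-path acyclic π r =
    subst (_⊆ _) (acyclic⇒path-unique acyclic (path S) π) (⊆walk S)
    where S = shortcut r

  concat-segments : ∀ m (z : Fin (suc (suc m)) → V G) {L : Fin (suc m) → List (V G)} →
                    (∀ i → Walk G (z (inject₁ i)) (z (fsuc i)) (L i)) →
                    ∃[ W ] Walk G (z zero) (z (fromℕ (suc m))) W × (∀ {t} → t ∈ W → ∃[ i ] t ∈ L i)
  concat-segments zero    z segment = _ , segment zero , (zero ,_)
  concat-segments (suc m) z {L} segment
    with W , r , W-cover ← concat-segments m (z ∘ fsuc) (segment ∘ fsuc) =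
    _ , segment zero ++ʷ r , cover
    where
    cover : ∀ {t} → t ∈ L zero ++ drop 1 W → ∃[ i ] t ∈ L i
    cover t∈ with ∈-++-drop-1⁻ _ t∈
    ... | inj₁ t∈L₀ = zero , t∈L₀
    ... | inj₂ t∈W with i , t∈Lᵢ ← W-cover t∈W = fsuc i , t∈Lᵢ

  path-through-segments :
    ∀ {m} → ¬ HasCycle G → (z : Fin (suc (suc m)) → V G) →
    (σ : ∀ i → ∃[ L ] Path G (z (inject₁ i)) (z (fsuc i)) L) →
    Path G (z zero) (z (fromℕ (suc m))) P → t ∈ P → ∃[ i ] t ∈ proj₁ (σ i)
  path-through-segments {m = m} acyclic z σ π t∈P
    with W , r , W-cover ← concat-segments m z (λ i → proj₁ (proj₂ (σ i))) =
    W-cover (walk-covers-path acyclic π r t∈P)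

  two-neighbours⇒2≤degree : u ≢ v → Adj G t u → Adj G t v → 2 ≤ degree G t
  two-neighbours⇒2≤degree {t = t} u≢v t~u t~v =
    unique-⊆⇒length≤ ((u≢v ∷ []) ∷ [] ∷ []) neighbour
    where
    neighbour : ∀ {z} → z ∈ _ ∷ _ ∷ [] → z ∈ filterᵇ (E G t) (allFin (n G))
    neighbour (here refl)         = ∈-filter⁺ _ (∈-allFin _) (Equivalence.from T-≡ t~u)
    neighbour (there (here refl)) = ∈-filter⁺ _ (∈-allFin _) (Equivalence.from T-≡ t~v)

  leaf-neighbour-unique : IsLeaf G t → Adj G t u → Adj G t v → u ≡ v
  leaf-neighbour-unique {u = u} {v} leaf t~u t~v with u ≟ v
  ... | yes u≡v = u≡v
  ... | no u≢v with s≤s () ← subst (2 ≤_) leaf (two-neighbours⇒2≤degree u≢v t~u t~v)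

  leaf∈path⇒endpoint : IsLeaf G t → Path G u v P → t ∈ P → t ≡ u ⊎ t ≡ v
  leaf∈path⇒endpoint _ (here , _)     (here t≡u) = inj₁ t≡u
  leaf∈path⇒endpoint _ (step _ _ , _) (here t≡u) = inj₁ t≡u
  leaf∈path⇒endpoint leaf (step u~a r , u∉ ∷ r!) (there t∈)
    with leaf∈path⇒endpoint leaf (r , r!) t∈ | r
  ... | inj₂ t≡v  | _            = inj₂ t≡v
  ... | inj₁ refl | here         = inj₂ refl
  ... | inj₁ refl | step a~b r′  =
    contradiction (leaf-neighbour-unique leaf (adj-sym u~a) a~b)
                  (All.lookup u∉ (there (walk-source∈ r′)))

  close-pairs⇒¬alternating :
    (h : V G → ℕ) (k : ℤ) → (∀ {u v} → u ≢ v → ¬ Adj G u v → k <ℤ + (h u + h v)) →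
    + (h a + h b) ≤ℤ k → + (h c + h d) ≤ℤ k → ¬ IsAltCycleVertexSet G (a ∷ b ∷ c ∷ d ∷ [])
  close-pairs⇒¬alternating h k far ab≤k cd≤k ([] , () , _)
  close-pairs⇒¬alternating h k far ab≤k cd≤k ((c₀ , d₀) ∷ [] , (_ , last c₀~d₀ d₀≁c₀) , _) =
    d₀≁c₀ (adj-sym c₀~d₀)
  close-pairs⇒¬alternating {a} {b} {c} {d} h k far ab≤k cd≤k
    ( (c₀ , d₀) ∷ (c₁ , d₁) ∷ []
    , (C!@((_ ∷ _ ∷ c₀≢d₁ ∷ []) ∷ (d₀≢c₁ ∷ _ ∷ []) ∷ _) , cons _ d₀≁c₁ (last _ d₁≁c₀))
    , C≈S) =
    above-twice≰below-twice (far d₀≢c₁ d₀≁c₁) (far (c₀≢d₁ ∘ ≡.sym) d₁≁c₀) ab≤k cd≤k (begin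
      (h d₀ + h c₁) + (h d₁ + h c₀)           ≡⟨ regroup (h c₀) (h d₀) (h c₁) (h d₁) ⟩
      sum (map h (c₀ ∷ d₀ ∷ c₁ ∷ d₁ ∷ []))   ≤⟨ unique-⊆⇒sum≤ h C! (Equivalence.to (C≈S _)) ⟩
      sum (map h (a ∷ b ∷ c ∷ d ∷ []))       ≡⟨ regroup′ (h a) (h b) (h c) (h d) ⟩
      (h a + h b) + (h c + h d)               ∎)
    where
    open ℕ.≤-Reasoning
    regroup : ∀ p q r s → (q + r) + (s + p) ≡ p + (q + (r + (s + 0)))
    regroup = solve-∀
    regroup′ : ∀ p q r s → p + (q + (r + (s + 0))) ≡ (p + q) + (r + s)
    regroup′ = solve-∀
  close-pairs⇒¬alternating h k far _ _ ((c₀ , d₀) ∷ (c₁ , d₁) ∷ (c₂ , d₂) ∷ C , (C! , _) , C≈S)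
    with s≤s (s≤s (s≤s (s≤s ()))) ← unique-⊆⇒length≤ C! (Equivalence.to (C≈S _))

module TreeMetric {T : Graph} (tree : IsTree T) (f : V T → V T → ℕ)
                  (f-sym : ∀ u v → f u v ≡ f v u) where

  open ℕ.≤-Reasoning

  geodesic : ∀ u v → ∃[ P ] Path T u v P
  geodesic = connecting-path (proj₁ tree)

  dist : V T → V T → ℕ
  dist u v = weight f (proj₁ (geodesic u v))

  dist-≤-walk : ∀ {u v W} → Walk T u v W → dist u v ≤ weight f W
  dist-≤-walk {u} {v} r =
    subst (_≤ _) (cong (weight f) (acyclic⇒path-unique (proj₂ tree) (path S) (proj₂ (geodesic u v))))
          (weight≤ S f)
    where S = shortcut r

  dist-≤-via : ∀ t u v → dist u v ≤ dist t u + dist t v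
  dist-≤-via t u v = begin
    dist u v                             ≤⟨ dist-≤-walk (reverseʷ γᵤ ++ʷ γᵥ) ⟩
    weight f (reverse Γᵤ ++ drop 1 Γᵥ)   ≡⟨ weight-++ʷ f (reverseʷ γᵤ) γᵥ ⟩
    weight f (reverse Γᵤ) + dist t v     ≡⟨ cong (_+ dist t v) (weight-reverseʷ f f-sym γᵤ) ⟩
    dist t u + dist t v                  ∎
    where
    Γᵤ Γᵥ : List (V T)
    Γᵤ = proj₁ (geodesic t u)
    Γᵥ = proj₁ (geodesic t v)
    γᵤ : Walk T t u Γᵤ
    γᵤ = proj₁ (proj₂ (geodesic t u))
    γᵥ : Walk T t v Γᵥ
    γᵥ = proj₁ (proj₂ (geodesic t v))

  dist-split : ∀ {u v P t} → Path T u v P → t ∈ P → dist t u + dist t v ≤ weight f P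
  dist-split {u} {v} {t = t} (r , _) t∈P with W₁ , W₂ , r₁ , r₂ , refl ← splitʷ r t∈P = begin
    dist t u + dist t v                       ≤⟨ ℕ.+-mono-≤ (dist-≤-walk (reverseʷ r₁)) (dist-≤-walk r₂) ⟩
    weight f (reverse W₁) + weight f W₂       ≡⟨ cong (_+ weight f W₂) (weight-reverseʷ f f-sym r₁) ⟩
    weight f W₁ + weight f W₂                 ≡⟨ weight-++ʷ f r₁ r₂ ⟨
    weight f (W₁ ++ drop 1 W₂)                ∎

crossing-edges⇒¬alternating :
  ∀ {G T ι f a b c d P Q t} → IsLeafRoot G T ι f → Adj G a b → Adj G c d →
  Path T (ι a) (ι b) P → Path T (ι c) (ι d) Q → t ∈ P → t ∈ Q →
  ¬ IsAltCycleVertexSet G (a ∷ b ∷ c ∷ d ∷ [])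
crossing-edges⇒¬alternating {G} {T} {ι} {f} {t = t}
  ((tree , _) , (f-sym , _) , k , cond) a~b c~d πP πQ t∈P t∈Q =
  close-pairs⇒¬alternating h k far (close a~b πP t∈P) (close c~d πQ t∈Q)
  where
  open TreeMetric tree f f-sym
  h : V G → ℕ
  h v = dist t (ι v)
  close : ∀ {u v R} → Adj G u v → Path T (ι u) (ι v) R → t ∈ R → + (h u + h v) ≤ℤ k
  close {u} {v} {R} u~v π t∈R =
    ℤ.≤-trans (+≤+ (dist-split π t∈R)) (Equivalence.to (cond u v (adj⇒≢ {G = G} u~v) R π) u~v)
  far : ∀ {u v} → u ≢ v → ¬ Adj G u v → k <ℤ + (h u + h v)
  far {u} {v} u≢v u≁v = ℤ.≰⇒> λ hu+hv≤k →
    u≁v (Equivalence.from (cond u v u≢v _ (proj₂ (geodesic (ι u) (ι v))))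
                          (ℤ.≤-trans (+≤+ (dist-≤-via t (ι u) (ι v))) hu+hv≤k))

containsQuartet-aa : ∀ {G T ι a c d} → HasLeafSet G T ι → a ≢ c → a ≢ d →
                     ContainsQuartet G T ι a a c d
containsQuartet-aa {ι = ι} {a} (_ , ι-inj , leaves) a≢c a≢d P Q πP πQ t t∈P t∈Q
  with refl ← self-path πP t∈P
  with leaf∈path⇒endpoint (Equivalence.from (leaves (ι a)) (a , refl)) πQ t∈Q
... | inj₁ ιa≡ιc = a≢c (ι-inj ιa≡ιc)
... | inj₂ ιa≡ιd = a≢d (ι-inj ιa≡ιd)

lemma5 : (G : Graph) (p q : ℕ) (x : Fin (suc p) → V G) (y : Fin (suc q) → V G) →
    IsGraphPath G p x → IsGraphPath G q y →
    (∀ i j → x i ≢ y j) →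
    (∀ (i : Fin p) (j : Fin q) →
      IsAltCycleVertexSet G (x (inject₁ i) ∷ x (fsuc i) ∷ y (inject₁ j) ∷ y (fsuc j) ∷ [])) →
    InRQ G (x zero) (x (fromℕ p)) (y zero) (y (fromℕ q))
lemma5 G zero q x y _ _ x≢y _ T ι (_ , leaf-set , _) =
  containsQuartet-aa {G} {T} {ι} leaf-set (x≢y zero zero) (x≢y zero (fromℕ q))
lemma5 G p zero x y _ _ x≢y _ T ι (_ , leaf-set , _) P Q πP πQ t t∈P t∈Q =
  containsQuartet-aa {G} {T} {ι} leaf-set (x≢y zero zero ∘ ≡.sym) (x≢y (fromℕ p) zero ∘ ≡.sym)
    Q P πQ πP t t∈Q t∈P
lemma5 G (suc p) (suc q) x y (_ , x-adj) (_ , y-adj) _ alt T ι (_ , root@(((conn , acyclic) , _) , _))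
       P Q πP πQ t t∈P t∈Q
  with i , t∈xᵢxᵢ₊₁ ← path-through-segments acyclic (ι ∘ x) (λ _ → connecting-path conn _ _) πP t∈P
     | j , t∈yⱼyⱼ₊₁ ← path-through-segments acyclic (ι ∘ y) (λ _ → connecting-path conn _ _) πQ t∈Q
  = crossing-edges⇒¬alternating root (x-adj i) (y-adj j) (proj₂ (connecting-path conn _ _))
      (proj₂ (connecting-path conn _ _)) t∈xᵢxᵢ₊₁ t∈yⱼyⱼ₊₁ (alt i j)
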